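{- Let $G=K_{p,q}$ with $2\leq p\leq q$. Then $\ell_2(G)=\binom{p}{2}+\binom{q}{2}$ unless $p=q=2$. In particular, if $p+q\geq 6$, then $\ell_2(G)\geq p+q=|V(G)|$.
   Context: $d$ is the shortest-path distance. For distinct vertices $x,y$, $\overline{xy}^G=\{z: d(x,y)=d(x,z)+d(z,y)\ \text{or}\ d(x,y)=|d(x,z)-d(z,y)|\}$. $\ell_2(G)$ is the number of distinct sets $\overline{xy}^G$ over pairs $x,y$ with $d(x,y)=2$. -}

module Defs where

open import Data.Bool using (Bool; true; false; _∧_; _∨_; _xor_; not)
open import Data.Bool.Properties renaming (_≟_ to _≟𝔹_)
open import Data.Nat using (ℕ; zero; suc; _+_; _≡ᵇ_; _<ᵇ_; ∣_-_∣)
open import Data.Fin using (Fin; toℕ)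
open import Data.Vec using (Vec; tabulate)
open import Data.Vec.Properties using (≡-dec)
open import Data.Bool.ListAction using (any)
open import Data.List using (List; allFin; filterᵇ; cartesianProduct; map; deduplicate; length)
open import Data.Product using (_×_; _,_; proj₁; proj₂)

Graph : ℕ → Set
Graph n = Fin n → Fin n → Bool

-- Complete bipartite graph K_{p,q} on Fin (p + q):
-- vertices with index < p form one side, the remaining q vertices the other.
K : (p q : ℕ) → Graph (p + q)
K p q i j = (toℕ i <ᵇ p) xor (toℕ j <ᵇ p)

walk? : ∀ {n} → Graph n → ℕ → Fin n → Fin n → Bool
walk? {n} G zero    x y = toℕ x ≡ᵇ toℕ y
walk? {n} G (suc k) x y = any (λ z → G x z ∧ walk? G k z y) (allFin n)

-- least k in [i, i + fuel) with a walk of length k (fuel exhausted: returns i + fuel)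
search : ∀ {n} → Graph n → Fin n → Fin n → ℕ → ℕ → ℕ
search G x y i zero = i
search G x y i (suc fuel) with walk? G i x y
... | true  = i
... | false = search G x y (suc i) fuel

-- Shortest-path distance d(x,y): least k with a walk of length k from x to y
-- (any shortest walk has length < n; the value n stands for "unreachable").
dist : ∀ {n} → Graph n → Fin n → Fin n → ℕ
dist {n} G x y = search G x y 0 n

line : ∀ {n} → Graph n → Fin n → Fin n → Vec Bool n
line G x y = tabulate λ z →
  (dist G x y ≡ᵇ (dist G x z + dist G z y)) ∨ (dist G x y ≡ᵇ ∣ dist G x z - dist G z y ∣)

pairs₂ : ∀ {n} → Graph n → List (Fin n × Fin n)
pairs₂ {n} G = filterᵇ (λ xy → dist G (proj₁ xy) (proj₂ xy) ≡ᵇ 2)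
                       (cartesianProduct (allFin n) (allFin n))

ℓ₂ : ∀ {n} → Graph n → ℕ
ℓ₂ G = length (deduplicate (≡-dec _≟𝔹_) (map (λ xy → line G (proj₁ xy) (proj₂ xy)) (pairs₂ G)))

module Submission where

-- For p, q ≥ 1 the graph has diameter two: d(x,y) is 0, 1 or 2 according as
-- x = y, x and y lie on different sides, or x ≠ y lie on the same side.
-- Consequently, for a same-side pair x ≠ y a vertex z lies on the line xy
-- iff z ∈ {x, y} or z is on the other side, i.e.  xy = {x, y} ∪ (other side).
-- When the larger side has at least three vertices these lines are pairwise
-- distinct: on its own side a line xy meets only x and y, and a line through
-- a pair of the other side omits a vertex of the larger side.  Hence the
-- distance-two lines are in bijection with the same-side pairs a < b, of
-- which there are C(p,2) + C(q,2).
--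
-- The theorem then follows using p + q ≤ C(p,2) + C(q,2) for p + q ≥ 6.

open import Defs
open import Data.Bool using (Bool; true; false; not; _∧_; _∨_; _xor_; T)
open import Data.Bool.Properties
  using (∨-assoc; ∨-comm; ∨-zeroʳ; xor-same; xor-comm; T-≡; T-∧)
  renaming (_≟_ to _≟𝔹_)
open import Data.Empty using (⊥; ⊥-elim)
open import Data.Fin using (Fin; toℕ; fromℕ<)
open import Data.Fin.Properties using (toℕ-injective; toℕ-fromℕ<; toℕ<n)
open import Data.List using (List; []; _++_; map; upTo; allFin; length; deduplicate; cartesianProduct)
open import Data.List.Properties using (length-++; length-map; length-upTo)
open import Data.List.Membership.Propositional using (_∈_; lose)
open import Data.List.Membership.Propositional.Properties
  using ( ∈-++⁺ˡ; ∈-++⁺ʳ; ∈-++⁻; ∈-map⁺; ∈-map⁻; ∈-upTo⁺; ∈-upTo⁻; ∈-allFin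
        ; ∈-filter⁺; ∈-filter⁻; ∈-cartesianProduct⁺; ∈-deduplicate⁺; ∈-deduplicate⁻)
open import Data.List.Membership.Propositional.Properties.WithK using (unique∧set⇒bag)
open import Data.List.Relation.Binary.BagAndSetEquality using (∼bag⇒↭)
open import Data.List.Relation.Binary.Permutation.Propositional.Properties using (↭-length)
open import Data.List.Relation.Unary.All as All using (All; []; _∷_)
open import Data.List.Relation.Unary.All.Properties using () renaming (map⁺ to All-map⁺)
open import Data.List.Relation.Unary.Any using (satisfied)
open import Data.List.Relation.Unary.Any.Properties using (any⁺; any⁻)
open import Data.List.Relation.Unary.AllPairs using ([]; _∷_)
open import Data.List.Relation.Unary.Unique.Propositional using (Unique)
import Data.List.Relation.Unary.Unique.Propositional.Properties as Unique
open import Data.List.Relation.Unary.Unique.DecPropositional.Properties using (deduplicate-!)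
open import Data.Nat using (ℕ; zero; suc; _+_; _∸_; _≤_; _<_; _≡ᵇ_; _<ᵇ_; ∣_-_∣; z≤n; s≤s)
open import Data.Nat.Properties
open import Data.Nat.Combinatorics using (_C_; nC1≡n; nCk+nC[k+1]≡[n+1]C[k+1])
open import Data.Product using (_×_; _,_; proj₁; proj₂; ∃)
open import Data.Sum using (_⊎_; inj₁; inj₂; [_,_])
open import Data.Vec using (Vec; tabulate; lookup)
open import Data.Vec.Properties using (tabulate-cong; lookup∘tabulate; ≡-dec)
open import Function using (_∘_; _⇔_; mk⇔; Equivalence)
open import Relation.Binary.Definitions using (DecidableEquality; tri<; tri≈; tri>)
open import Relation.Binary.PropositionalEquality hiding ([_])
open import Relation.Nullary using (¬_; yes; no; contradiction)
open import Relation.Nullary.Decidable using (dec-true; dec-false)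
open import Relation.Nullary.Decidable.Core using (T?)

open ≡-Reasoning

T⇒true : ∀ {b} → T b → b ≡ true
T⇒true = Equivalence.to T-≡

¬T⇒false : ∀ {b} → ¬ T b → b ≡ false
¬T⇒false {false} _  = refl
¬T⇒false {true}  ¬t = ⊥-elim (¬t _)

≡ᵇ-refl : ∀ m → (m ≡ᵇ m) ≡ true
≡ᵇ-refl m = dec-true (m ≟ m) refl

≡ᵇ-false : ∀ {m n} → m ≢ n → (m ≡ᵇ n) ≡ false
≡ᵇ-false {m} {n} = dec-false (m ≟ n)

≡ᵇ-false⁻ : ∀ {m n} → (m ≡ᵇ n) ≡ false → m ≢ n
≡ᵇ-false⁻ {m} m≢ᵇn refl = contradiction (trans (sym m≢ᵇn) (≡ᵇ-refl m)) λ ()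

≡ᵇ-sound : ∀ {m n} → (m ≡ᵇ n) ≡ true → m ≡ n
≡ᵇ-sound {m} {n} e = ≡ᵇ⇒≡ m n (subst T (sym e) _)

≡ᵇ-sym : ∀ m n → (m ≡ᵇ n) ≡ (n ≡ᵇ m)
≡ᵇ-sym zero    zero    = refl
≡ᵇ-sym zero    (suc n) = refl
≡ᵇ-sym (suc m) zero    = refl
≡ᵇ-sym (suc m) (suc n) = ≡ᵇ-sym m n

xor-false⇒≡ : ∀ x y → (x xor y) ≡ false → x ≡ y
xor-false⇒≡ true  true  _ = refl
xor-false⇒≡ false false _ = refl

Pairs : ℕ → List (ℕ × ℕ)
Pairs zero    = []
Pairs (suc m) = Pairs m ++ map (_, m) (upTo m)

∈-Pairs⁻ : ∀ m {a b} → (a , b) ∈ Pairs m → a < b × b < m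
∈-Pairs⁻ (suc m) ab∈ with ∈-++⁻ (Pairs m) ab∈
... | inj₁ old = let a<b , b<m = ∈-Pairs⁻ m old in a<b , m<n⇒m<1+n b<m
... | inj₂ new with _ , a∈ , refl ← ∈-map⁻ (_, m) new = ∈-upTo⁻ a∈ , n<1+n m

∈-Pairs⁺ : ∀ m {a b} → a < b → b < m → (a , b) ∈ Pairs m
∈-Pairs⁺ (suc m) a<b (s≤s b≤m) with m≤n⇒m<n∨m≡n b≤m
... | inj₁ b<m  = ∈-++⁺ˡ (∈-Pairs⁺ m a<b b<m)
... | inj₂ refl = ∈-++⁺ʳ (Pairs m) (∈-map⁺ (_, m) (∈-upTo⁺ a<b))

Pairs-unique : ∀ m → Unique (Pairs m)
Pairs-unique zero    = []
Pairs-unique (suc m) =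
  Unique.++⁺ (Pairs-unique m) (Unique.map⁺ (cong proj₁) (Unique.upTo⁺ m)) disjoint
  where
  -- old pairs have second component < m, new ones have second component m
  disjoint : ∀ {ab} → ¬ (ab ∈ Pairs m × ab ∈ map (_, m) (upTo m))
  disjoint (old , new) with _ , _ , refl ← ∈-map⁻ (_, m) new =
    <-irrefl refl (proj₂ (∈-Pairs⁻ m old))

C2-suc : ∀ m → suc m C 2 ≡ m + m C 2
C2-suc m = begin
  suc m C 2       ≡⟨ nCk+nC[k+1]≡[n+1]C[k+1] m 1 ⟨
  m C 1 + m C 2   ≡⟨ cong (_+ m C 2) (nC1≡n m) ⟩
  m + m C 2       ∎

length-Pairs : ∀ m → length (Pairs m) ≡ m C 2
length-Pairs zero    = refl
length-Pairs (suc m) = begin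
  length (Pairs m ++ map (_, m) (upTo m))          ≡⟨ length-++ (Pairs m) ⟩
  length (Pairs m) + length (map (_, m) (upTo m))  ≡⟨ cong₂ _+_ (length-Pairs m) (trans (length-map _ (upTo m)) (length-upTo m)) ⟩
  m C 2 + m                                        ≡⟨ +-comm (m C 2) m ⟩
  m + m C 2                                        ≡⟨ C2-suc m ⟨
  suc m C 2                                        ∎

ordered-pair-≡ : ∀ {a b c d : ℕ} → a < b → c < d → a ≡ c ⊎ a ≡ d → b ≡ c ⊎ b ≡ d → (a , b) ≡ (c , d)
ordered-pair-≡ _   _   (inj₁ refl) (inj₂ refl) = refl
ordered-pair-≡ a<b _   (inj₁ refl) (inj₁ refl) = ⊥-elim (<-irrefl refl a<b)
ordered-pair-≡ a<b _   (inj₂ refl) (inj₂ refl) = ⊥-elim (<-irrefl refl a<b)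
ordered-pair-≡ a<b c<d (inj₂ refl) (inj₁ refl) = ⊥-elim (<-irrefl refl (<-trans c<d a<b))

avoid-one-above : ∀ m e → ∃ λ w → m < w × w < 3 + m × w ≢ e
avoid-one-above m e with suc m ≟ e
... | no  m+1≢e = suc m , n<1+n m , s≤s (n≤1+n (suc m)) , m+1≢e
... | yes refl  = suc (suc m) , s≤s (n≤1+n m) , n<1+n _ , 1+n≢n

avoid-two : ∀ m c d → ∃ λ w → m ≤ w × w < 3 + m × w ≢ c × w ≢ d
avoid-two m c d with m ≟ c | m ≟ d
... | no m≢c | no m≢d = m , ≤-refl , m<n+m m (s≤s z≤n) , m≢c , m≢d
... | yes refl | _ = let w , m<w , w<3+m , w≢d = avoid-one-above m d
                     in w , <⇒≤ m<w , w<3+m , ≢-sym (<⇒≢ m<w) , w≢d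
... | no _ | yes refl = let w , m<w , w<3+m , w≢c = avoid-one-above m c
                        in w , <⇒≤ m<w , w<3+m , w≢c , ≢-sym (<⇒≢ m<w)

length-deduplicate : ∀ {A : Set} (_≟_ : DecidableEquality A) {xs ys : List A} →
                     Unique ys → (∀ {v} → v ∈ xs ⇔ v ∈ ys) →
                     length (deduplicate _≟_ xs) ≡ length ys
length-deduplicate _≟_ {xs} {ys} ys! same = ↭-length (∼bag⇒↭ (unique∧set⇒bag (deduplicate-! _≟_ xs) ys! same′))
  where
  same′ : ∀ {v} → v ∈ deduplicate _≟_ xs ⇔ v ∈ ys
  same′ = mk⇔ (Equivalence.to same ∘ ∈-deduplicate⁻ _≟_ xs)
              (∈-deduplicate⁺ _≟_ ∘ Equivalence.from same)

Unique-map-on : ∀ {A B : Set} (P : A → Set) {f : A → B} →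
                (∀ {x y} → P x → P y → f x ≡ f y → x ≡ y) →
                ∀ {xs} → All P xs → Unique xs → Unique (map f xs)
Unique-map-on P inj [] [] = []
Unique-map-on P inj (px ∷ pxs) (x∉xs ∷ xs!) =
  All-map⁺ (All.zipWith (λ (py , x≢y) → x≢y ∘ inj px py) (pxs , x∉xs))
  ∷ Unique-map-on P inj pxs xs!

walk-1 : ∀ {n} (G : Graph n) (x y : Fin n) → walk? G 1 x y ≡ G x y
walk-1 {n} G x y with G x y in adj
... | true  = T⇒true (any⁺ _ (lose (∈-allFin y) (subst T (sym (cong₂ _∧_ adj (≡ᵇ-refl (toℕ y)))) _)))
... | false = ¬T⇒false λ walk →
  let z , t = satisfied (any⁻ _ (allFin n) walk)
      xz , zy = Equivalence.to T-∧ t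
      z≡y = toℕ-injective (≡ᵇ⇒≡ (toℕ z) (toℕ y) zy)
  in subst T (trans (cong (G x) z≡y) adj) xz

walk-2 : ∀ {n} (G : Graph n) (x z y : Fin n) → G x z ≡ true → G z y ≡ true → walk? G 2 x y ≡ true
walk-2 {n} G x z y xz zy =
  T⇒true (any⁺ _ (lose (∈-allFin z) (subst T (sym (cong₂ _∧_ xz (trans (walk-1 G z y) zy))) _)))

search-hit : ∀ {n} (G : Graph n) x y {i} f → walk? G i x y ≡ true → search G x y i (suc f) ≡ i
search-hit G x y f hit rewrite hit = refl

search-miss : ∀ {n} (G : Graph n) x y {i} f → walk? G i x y ≡ false →
              search G x y i (suc f) ≡ search G x y (suc i) f
search-miss G x y f miss rewrite miss = refl

profile : Bool → Bool → ℕ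
profile true  _     = 0
profile false true  = 1
profile false false = 2

profile≡2 : ∀ e a → profile e a ≡ 2 → e ≡ false × a ≡ false
profile≡2 false false _ = refl , refl

-- If non-adjacent vertices are joined by a walk of length two, the distance
-- is given by `profile` (three vertices are needed so that the search for
-- a walk does not run out of candidate lengths before reaching two).
dist-diameter-2 : ∀ {n} (G : Graph n) → 3 ≤ n → (x y : Fin n) →
                  (G x y ≡ false → walk? G 2 x y ≡ true) →
                  dist G x y ≡ profile (toℕ x ≡ᵇ toℕ y) (G x y)
dist-diameter-2 {suc (suc (suc f))} G (s≤s (s≤s (s≤s _))) x y walk2
  with toℕ x ≡ᵇ toℕ y | G x y in adj
... | true  | _     = refl
... | false | true  = search-hit G x y _ (trans (walk-1 G x y) adj)
... | false | false = begin
  search G x y 1 (2 + f)  ≡⟨ search-miss G x y _ (trans (walk-1 G x y) adj) ⟩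
  search G x y 2 (1 + f)  ≡⟨ search-hit G x y _ (walk2 refl) ⟩   -- G x y is false in this case
  2                       ∎

collinear : ℕ → ℕ → ℕ → Bool
collinear d d₁ d₂ = (d ≡ᵇ d₁ + d₂) ∨ (d ≡ᵇ ∣ d₁ - d₂ ∣)

collinear-2 : ∀ ex ey a → ¬ (ex ≡ true × ey ≡ true) → (ex ≡ true → a ≡ false) → (ey ≡ true → a ≡ false) →
              collinear 2 (profile ex a) (profile ey a) ≡ (ex ∨ ey ∨ a)
collinear-2 true  true  _     both _ _ = ⊥-elim (both (refl , refl))
collinear-2 true  false false _    _ _ = refl
collinear-2 true  false true  _    h _ with () ← h refl
collinear-2 false true  false _    _ _ = refl
collinear-2 false true  true  _    _ h with () ← h refl
collinear-2 false false false _    _ _ = refl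
collinear-2 false false true  _    _ _ = refl

∈-pairs₂ : ∀ {n} (G : Graph n) {x y : Fin n} → (x , y) ∈ pairs₂ G ⇔ dist G x y ≡ 2
∈-pairs₂ {n} G {x} {y} = mk⇔
  (λ xy∈ → ≡ᵇ⇒≡ _ 2 (proj₂ (∈-filter⁻ (T? ∘ isPair) {xs = cartesianProduct (allFin n) (allFin n)} xy∈)))
  (λ d≡2 → ∈-filter⁺ (T? ∘ isPair) (∈-cartesianProduct⁺ (∈-allFin x) (∈-allFin y)) (≡⇒≡ᵇ _ 2 d≡2))
  where
  isPair : Fin n × Fin n → Bool
  isPair (u , v) = dist G u v ≡ᵇ 2

vertex : ∀ {n a} → a < n → ∃ λ (x : Fin n) → toℕ x ≡ a
vertex a<n = fromℕ< a<n , toℕ-fromℕ< a<n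

module Bipartite (p q : ℕ) where

  -- The side of a vertex number: true for the first p vertices.  By
  -- definition, K p q x y ≡ side (toℕ x) xor side (toℕ y).
  side : ℕ → Bool
  side a = a <ᵇ p

  side-true : ∀ {a} → a < p → side a ≡ true
  side-true {a} = dec-true (a <? p)

  side-false : ∀ {a} → p ≤ a → side a ≡ false
  side-false {a} p≤a = dec-false (a <? p) (≤⇒≯ p≤a)

  side-false⁻ : ∀ {a} → side a ≡ false → p ≤ a
  side-false⁻ sa = ≮⇒≥ λ a<p → contradiction (trans (sym sa) (side-true a<p)) λ ()

  SameSidePair : ℕ × ℕ → Set
  SameSidePair (a , b) = a < b × b < p + q × side a ≡ side b

  shift : ℕ × ℕ → ℕ × ℕ
  shift (a , b) = p + a , p + b

  sameSidePairs : List (ℕ × ℕ)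
  sameSidePairs = Pairs p ++ map shift (Pairs q)

  ∈-sameSidePairs⁻ : ∀ {ab} → ab ∈ sameSidePairs → SameSidePair ab
  ∈-sameSidePairs⁻ ab∈ with ∈-++⁻ (Pairs p) ab∈
  ... | inj₁ first = let a<b , b<p = ∈-Pairs⁻ p first
                     in a<b , ≤-trans b<p (m≤m+n p q) , trans (side-true (<-trans a<b b<p)) (sym (side-true b<p))
  ... | inj₂ second with (c , d) , cd∈ , refl ← ∈-map⁻ shift second =
    let c<d , d<q = ∈-Pairs⁻ q cd∈
    in +-monoʳ-< p c<d , +-monoʳ-< p d<q , trans (side-false (m≤m+n p c)) (sym (side-false (m≤m+n p d)))

  ∈-sameSidePairs⁺ : ∀ {a b} → SameSidePair (a , b) → (a , b) ∈ sameSidePairs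
  ∈-sameSidePairs⁺ {a} {b} (a<b , b<n , same) with b <? p
  ... | yes b<p = ∈-++⁺ˡ (∈-Pairs⁺ p a<b b<p)
  ... | no  b≮p = ∈-++⁺ʳ (Pairs p) (subst (_∈ map shift (Pairs q)) unshift (∈-map⁺ shift (∈-Pairs⁺ q a-p<b-p b-p<q)))
    where
    p≤b : p ≤ b
    p≤b = ≮⇒≥ b≮p
    p≤a : p ≤ a
    p≤a = side-false⁻ (trans same (side-false p≤b))
    a-p<b-p : a ∸ p < b ∸ p
    a-p<b-p = ∸-monoˡ-< a<b p≤a
    b-p<q : b ∸ p < q
    b-p<q = +-cancelˡ-< p (b ∸ p) q (subst (_< p + q) (sym (m+[n∸m]≡n p≤b)) b<n)
    unshift : shift (a ∸ p , b ∸ p) ≡ (a , b)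
    unshift = cong₂ _,_ (m+[n∸m]≡n p≤a) (m+[n∸m]≡n p≤b)

  sameSidePairs-unique : Unique sameSidePairs
  sameSidePairs-unique = Unique.++⁺ (Pairs-unique p) (Unique.map⁺ shift-injective (Pairs-unique q)) disjoint
    where
    shift-injective : ∀ {ab cd} → shift ab ≡ shift cd → ab ≡ cd
    shift-injective {a , b} {c , d} e = cong₂ _,_ (+-cancelˡ-≡ p a c (cong proj₁ e)) (+-cancelˡ-≡ p b d (cong proj₂ e))
    -- first components are < p in the first block and ≥ p in the second
    disjoint : ∀ {ab} → ¬ (ab ∈ Pairs p × ab ∈ map shift (Pairs q))
    disjoint (first , second) with (c , _) , _ , refl ← ∈-map⁻ shift second =
      let a<b , b<p = ∈-Pairs⁻ p first in <-irrefl refl (<-≤-trans (<-trans a<b b<p) (m≤m+n p c))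

  length-sameSidePairs : length sameSidePairs ≡ p C 2 + q C 2
  length-sameSidePairs = begin
    length (Pairs p ++ map shift (Pairs q))          ≡⟨ length-++ (Pairs p) ⟩
    length (Pairs p) + length (map shift (Pairs q))  ≡⟨ cong (length (Pairs p) +_) (length-map shift (Pairs q)) ⟩
    length (Pairs p) + length (Pairs q)              ≡⟨ cong₂ _+_ (length-Pairs p) (length-Pairs q) ⟩
    p C 2 + q C 2                                    ∎

  -- The line through same-side vertices a ≠ b: {a, b} together with the other side.
  inLine : ℕ → ℕ → ℕ → Bool
  inLine a b w = (w ≡ᵇ a) ∨ (w ≡ᵇ b) ∨ (side a xor side w)

  lineK : ℕ × ℕ → Vec Bool (p + q)
  lineK (a , b) = tabulate (inLine a b ∘ toℕ)

  inLine-first : ∀ a b → inLine a b a ≡ true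
  inLine-first a b rewrite ≡ᵇ-refl a = refl

  inLine-second : ∀ a b → inLine a b b ≡ true
  inLine-second a b rewrite ≡ᵇ-refl b = ∨-zeroʳ (b ≡ᵇ a)

  inLine-opposite : ∀ a b w → side a ≡ true → side w ≡ false → inLine a b w ≡ true
  inLine-opposite a b w sa sw rewrite sa | sw | ∨-zeroʳ (w ≡ᵇ b) = ∨-zeroʳ (w ≡ᵇ a)

  inLine-same-side : ∀ {a b w} → side w ≡ side a → inLine a b w ≡ true → w ≡ a ⊎ w ≡ b
  inLine-same-side {a} {b} {w} same on with w ≟ a | w ≟ b
  ... | yes w≡a | _       = inj₁ w≡a
  ... | no  _   | yes w≡b = inj₂ w≡b
  ... | no  w≢a | no  w≢b = contradiction (trans (sym on) off) λ ()
    where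
    off : inLine a b w ≡ false
    off rewrite ≡ᵇ-false w≢a | ≡ᵇ-false w≢b | same = xor-same (side a)

  lineK-sym : ∀ {a b} → side a ≡ side b → lineK (a , b) ≡ lineK (b , a)
  lineK-sym {a} {b} same = tabulate-cong λ z → let w = toℕ z in begin
    (w ≡ᵇ a) ∨ (w ≡ᵇ b) ∨ (side a xor side w)    ≡⟨ ∨-assoc (w ≡ᵇ a) _ _ ⟨
    ((w ≡ᵇ a) ∨ (w ≡ᵇ b)) ∨ (side a xor side w)  ≡⟨ cong₂ _∨_ (∨-comm (w ≡ᵇ a) _) (cong (_xor side w) same) ⟩
    ((w ≡ᵇ b) ∨ (w ≡ᵇ a)) ∨ (side b xor side w)  ≡⟨ ∨-assoc (w ≡ᵇ b) _ _ ⟩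
    (w ≡ᵇ b) ∨ (w ≡ᵇ a) ∨ (side b xor side w)    ∎

  lineK-agree : ∀ {a b c d w} → lineK (a , b) ≡ lineK (c , d) → w < p + q → inLine a b w ≡ inLine c d w
  lineK-agree {a} {b} {c} {d} eq w<n with v , refl ← vertex w<n = begin
    inLine a b (toℕ v)        ≡⟨ lookup∘tabulate _ v ⟨
    lookup (lineK (a , b)) v  ≡⟨ cong (λ l → lookup l v) eq ⟩
    lookup (lineK (c , d)) v  ≡⟨ lookup∘tabulate _ v ⟩
    inLine c d (toℕ v)        ∎

  lineK-injective-same-side : ∀ {a b c d} → SameSidePair (a , b) → SameSidePair (c , d) → side a ≡ side c →
                              lineK (a , b) ≡ lineK (c , d) → (a , b) ≡ (c , d)
  lineK-injective-same-side {a} {b} (a<b , b<n , sab) (c<d , _ , _) sac eq =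
    ordered-pair-≡ a<b c<d
      (inLine-same-side sac (trans (sym (lineK-agree eq (<-trans a<b b<n))) (inLine-first a b)))
      (inLine-same-side (trans (sym sab) sac) (trans (sym (lineK-agree eq b<n)) (inLine-second a b)))

  -- A line through a pair of the first side contains the whole second side,
  -- while a line through a pair of the second side misses one of its first
  -- three vertices.
  lineK-cross-distinct : 3 ≤ q → ∀ {a b c d} → side a ≡ true → side c ≡ false →
                         lineK (a , b) ≢ lineK (c , d)
  lineK-cross-distinct q≥3 {a} {b} {c} {d} sa sc eq with w , p≤w , w<3+p , w≢c , w≢d ← avoid-two p c d =
    [ w≢c , w≢d ] (inLine-same-side (trans sw (sym sc)) (trans (sym (lineK-agree eq w<n)) (inLine-opposite a b w sa sw)))
    where
    sw : side w ≡ false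
    sw = side-false p≤w
    w<n : w < p + q
    w<n = <-≤-trans w<3+p (≤-trans (≤-reflexive (+-comm 3 p)) (+-monoʳ-≤ p q≥3))

  lineK-injective : 3 ≤ q → ∀ {ab cd} → SameSidePair ab → SameSidePair cd → lineK ab ≡ lineK cd → ab ≡ cd
  lineK-injective q≥3 {a , b} {c , d} P Q eq with side a ≟𝔹 side c
  ... | yes sac   = lineK-injective-same-side P Q sac eq
  ... | no  sa≢sc = ⊥-elim (opposite-sides (side a) (side c) refl refl sa≢sc)
    where
    opposite-sides : ∀ x y → side a ≡ x → side c ≡ y → x ≢ y → ⊥
    opposite-sides true  false sa sc _  = lineK-cross-distinct q≥3 sa sc eq
    opposite-sides false true  sa sc _  = lineK-cross-distinct q≥3 sc sa (sym eq)
    opposite-sides true  true  _  _  ne = ne refl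
    opposite-sides false false _  _  ne = ne refl

  module Connected (p≥1 : 1 ≤ p) (q≥1 : 1 ≤ q) (n≥3 : 3 ≤ p + q) where

    G : Graph (p + q)
    G = K p q

    neighbour : (s : Bool) → ∃ λ (z : Fin (p + q)) → (s xor side (toℕ z)) ≡ true
    neighbour true  with z , z≡p ← vertex (m<m+n p q≥1) = z , cong not (side-false (≤-reflexive (sym z≡p)))
    neighbour false with z , z≡0 ← vertex (≤-trans p≥1 (m≤m+n p q)) = z , side-true (subst (_< p) (sym z≡0) p≥1)

    -- Same-side vertices have a common neighbour, so K_{p,q} has diameter two.
    dist-K : ∀ x y → dist G x y ≡ profile (toℕ x ≡ᵇ toℕ y) (G x y)
    dist-K x y = dist-diameter-2 G n≥3 x y common-neighbour
      where
      common-neighbour : G x y ≡ false → walk? G 2 x y ≡ true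
      common-neighbour nonadjacent with z , xz ← neighbour (side (toℕ x)) = walk-2 G x z y xz (begin
        side (toℕ z) xor side (toℕ y)  ≡⟨ cong (side (toℕ z) xor_) (xor-false⇒≡ _ _ nonadjacent) ⟨
        side (toℕ z) xor side (toℕ x)  ≡⟨ xor-comm (side (toℕ z)) _ ⟩
        side (toℕ x) xor side (toℕ z)  ≡⟨ xz ⟩
        true                           ∎)

    dist-same-side : ∀ x y → toℕ x ≢ toℕ y → side (toℕ x) ≡ side (toℕ y) → dist G x y ≡ 2
    dist-same-side x y x≢y same = trans (dist-K x y)
      (cong₂ profile (≡ᵇ-false x≢y) (trans (cong (side (toℕ x) xor_) (sym same)) (xor-same (side (toℕ x)))))

    distance-two⇒same-side : ∀ x y → dist G x y ≡ 2 → toℕ x ≢ toℕ y × side (toℕ x) ≡ side (toℕ y)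
    distance-two⇒same-side x y d≡2 =
      let x≢ᵇy , nonadjacent = profile≡2 _ _ (trans (sym (dist-K x y)) d≡2)
      in ≡ᵇ-false⁻ x≢ᵇy , xor-false⇒≡ _ _ nonadjacent

    line-K : ∀ x y → toℕ x ≢ toℕ y → side (toℕ x) ≡ side (toℕ y) → line G x y ≡ lineK (toℕ x , toℕ y)
    line-K x y x≢y same = tabulate-cong on-line
      where
      on-line : ∀ z → collinear (dist G x y) (dist G x z) (dist G z y) ≡ inLine (toℕ x) (toℕ y) (toℕ z)
      on-line z = begin
        collinear (dist G x y) (dist G x z) (dist G z y)  ≡⟨ cong (λ d → collinear d (dist G x z) (dist G z y)) (dist-same-side x y x≢y same) ⟩
        collinear 2 (dist G x z) (dist G z y)             ≡⟨ cong₂ (collinear 2) (dist-K x z) (trans (dist-K z y) (cong (profile z=y) zy≡xz)) ⟩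
        collinear 2 (profile x=z adj) (profile z=y adj)   ≡⟨ collinear-2 x=z z=y adj not-both at-x at-y ⟩
        x=z ∨ z=y ∨ adj                                   ≡⟨ cong (_∨ z=y ∨ adj) (≡ᵇ-sym (toℕ x) (toℕ z)) ⟩
        inLine (toℕ x) (toℕ y) (toℕ z)                    ∎
        where
        x=z z=y adj : Bool
        x=z = toℕ x ≡ᵇ toℕ z
        z=y = toℕ z ≡ᵇ toℕ y
        adj = G x z
        zy≡xz : G z y ≡ G x z
        zy≡xz = trans (cong (side (toℕ z) xor_) (sym same)) (xor-comm (side (toℕ z)) _)
        not-both : ¬ (x=z ≡ true × z=y ≡ true)
        not-both (e₁ , e₂) = x≢y (trans (≡ᵇ-sound e₁) (≡ᵇ-sound e₂))
        at-x : x=z ≡ true → adj ≡ false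
        at-x e = trans (cong (λ w → side (toℕ x) xor side w) (sym (≡ᵇ-sound {toℕ x} e))) (xor-same (side (toℕ x)))
        at-y : z=y ≡ true → adj ≡ false
        at-y e = trans (cong (side (toℕ x) xor_) (trans (cong side (≡ᵇ-sound e)) (sym same))) (xor-same (side (toℕ x)))

  -- The distance-two lines of K_{p,q} are exactly the lines of same-side
  -- pairs; when q ≥ 3 these are pairwise distinct, so they are counted by
  -- the same-side pairs.
  ℓ₂-K : 1 ≤ p → 3 ≤ q → ℓ₂ (K p q) ≡ p C 2 + q C 2
  ℓ₂-K p≥1 q≥3 = begin
    ℓ₂ (K p q)                        ≡⟨ length-deduplicate (≡-dec _≟𝔹_) lines-unique same-lines ⟩
    length (map lineK sameSidePairs)  ≡⟨ length-map lineK sameSidePairs ⟩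
    length sameSidePairs              ≡⟨ length-sameSidePairs ⟩
    p C 2 + q C 2                     ∎
    where
    open Connected p≥1 (≤-trans (s≤s z≤n) q≥3) (≤-trans q≥3 (m≤n+m q p))

    lineOf : Fin (p + q) × Fin (p + q) → Vec Bool (p + q)
    lineOf xy = line G (proj₁ xy) (proj₂ xy)

    lines-unique : Unique (map lineK sameSidePairs)
    lines-unique = Unique-map-on SameSidePair (lineK-injective q≥3) (All.tabulate ∈-sameSidePairs⁻) sameSidePairs-unique

    line∈lineKs : ∀ x y → toℕ x ≢ toℕ y → side (toℕ x) ≡ side (toℕ y) → line G x y ∈ map lineK sameSidePairs
    line∈lineKs x y x≢y same with <-cmp (toℕ x) (toℕ y)
    ... | tri< x<y _ _ = subst (_∈ _) (sym (line-K x y x≢y same))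
                           (∈-map⁺ lineK (∈-sameSidePairs⁺ (x<y , toℕ<n y , same)))
    ... | tri> _ _ y<x = subst (_∈ _) (sym (trans (line-K x y x≢y same) (lineK-sym same)))
                           (∈-map⁺ lineK (∈-sameSidePairs⁺ (y<x , toℕ<n x , sym same)))
    ... | tri≈ _ x≡y _ = contradiction x≡y x≢y

    lineK∈lines : ∀ {ab} → SameSidePair ab → lineK ab ∈ map lineOf (pairs₂ G)
    lineK∈lines (a<b , b<n , same) with x , refl ← vertex (<-trans a<b b<n) | y , refl ← vertex b<n =
      subst (_∈ _) (line-K x y (<⇒≢ a<b) same)
        (∈-map⁺ lineOf (Equivalence.from (∈-pairs₂ G) (dist-same-side x y (<⇒≢ a<b) same)))

    same-lines : ∀ {v} → v ∈ map lineOf (pairs₂ G) ⇔ v ∈ map lineK sameSidePairs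
    same-lines = mk⇔ to from
      where
      to : ∀ {v} → v ∈ map lineOf (pairs₂ G) → v ∈ map lineK sameSidePairs
      to v∈ with (x , y) , xy∈ , refl ← ∈-map⁻ lineOf v∈ =
        let x≢y , same = distance-two⇒same-side x y (Equivalence.to (∈-pairs₂ G) xy∈)
        in line∈lineKs x y x≢y same
      from : ∀ {v} → v ∈ map lineK sameSidePairs → v ∈ map lineOf (pairs₂ G)
      from v∈ with _ , ab∈ , refl ← ∈-map⁻ lineK v∈ = lineK∈lines (∈-sameSidePairs⁻ ab∈)

m≤mC2 : ∀ {m} → 3 ≤ m → m ≤ m C 2
m≤mC2 {suc (suc (suc k))} (s≤s (s≤s (s≤s _))) = from-3 k
  where
  from-3 : ∀ k → 3 + k ≤ (3 + k) C 2
  from-3 zero    = ≤-refl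
  from-3 (suc k) = subst (4 + k ≤_) (sym (C2-suc (3 + k))) (+-mono-≤ {1} (s≤s z≤n) (from-3 k))

m<mC2 : ∀ {m} → 4 ≤ m → m < m C 2
m<mC2 {suc (suc (suc (suc k)))} (s≤s (s≤s (s≤s (s≤s _)))) = from-4 k
  where
  from-4 : ∀ k → 4 + k < (4 + k) C 2
  from-4 zero    = n≤1+n 5
  from-4 (suc k) = subst (6 + k ≤_) (sym (C2-suc (4 + k))) (+-mono-≤ {1} (s≤s z≤n) (from-4 k))

sum≤C2+C2 : ∀ {p q} → 2 ≤ p → p ≤ q → 6 ≤ p + q → p + q ≤ p C 2 + q C 2
sum≤C2+C2 {suc (suc zero)}    (s≤s (s≤s _)) _   (s≤s (s≤s q≥4)) = s≤s (m<mC2 q≥4)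
sum≤C2+C2 {suc (suc (suc _))} (s≤s (s≤s _)) p≤q _ = +-mono-≤ (m≤mC2 p≥3) (m≤mC2 (≤-trans p≥3 p≤q))
  where
  p≥3 : 3 ≤ _
  p≥3 = s≤s (s≤s (s≤s z≤n))

larger-side≥3 : ∀ {p q} → 2 ≤ p → p ≤ q → ¬ (p ≡ 2 × q ≡ 2) → 3 ≤ q
larger-side≥3 {p} {q} p≥2 p≤q not-K22 with 3 ≤? q
... | yes q≥3 = q≥3
... | no  q≱3 = ⊥-elim (not-K22 (≤-antisym (≤-trans p≤q q≤2) p≥2 , ≤-antisym q≤2 (≤-trans p≥2 p≤q)))
  where
  q≤2 : q ≤ 2
  q≤2 = ≤-pred (≰⇒> q≱3)

lemma3 : (p q : ℕ) → 2 ≤ p → p ≤ q →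
         (¬ (p ≡ 2 × q ≡ 2) → ℓ₂ (K p q) ≡ p C 2 + q C 2)
         × (6 ≤ p + q → p + q ≤ ℓ₂ (K p q))
lemma3 p q p≥2 p≤q = count , bound
  where
  count : ¬ (p ≡ 2 × q ≡ 2) → ℓ₂ (K p q) ≡ p C 2 + q C 2
  count not-K22 = Bipartite.ℓ₂-K p q (≤-trans (s≤s z≤n) p≥2) (larger-side≥3 p≥2 p≤q not-K22)

  -- K_{2,2} has only four vertices, so it is excluded by p + q ≥ 6.
  bound : 6 ≤ p + q → p + q ≤ ℓ₂ (K p q)
  bound n≥6 = subst (p + q ≤_) (sym (count not-K22)) (sum≤C2+C2 p≥2 p≤q n≥6)
    where
    not-K22 : ¬ (p ≡ 2 × q ≡ 2)
    not-K22 (refl , refl) = <⇒≱ (n≤1+n 5) n≥6
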